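{- The only $k$-Ore graph $G$ with $T^{k-1}(G) = 1$ is $K_k$.
   Context: Ore composition of $H_1,H_2$: delete an edge $xy$ of $H_1$; split a vertex $z$ of $H_2$ into two vertices $z_1,z_2$ of positive degree with $N(z_1)\cup N(z_2)=N(z)$ and $N(z_1)\cap N(z_2)=\emptyset$; identify $x$ with $z_1$ and $y$ with $z_2$. A graph is $k$-Ore if it is $K_k$ or an Ore composition of two $k$-Ore graphs. $T^{k-1}(G)$ is the maximum number of pairwise vertex-disjoint $K_{k-1}$ subgraphs of $G$. -}

module Defs where

open import Data.Nat using (ℕ; _≤_; _∸_)
open import Data.Fin using (Fin; _≟_)
open import Data.Bool using (Bool; true; false; not; _∧_; _∨_)
open import Data.Sum using (_⊎_; inj₁; inj₂)
open import Data.Product using (Σ; ∃; _×_; _,_; proj₁)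
open import Relation.Binary.PropositionalEquality using (_≡_; _≢_)
open import Data.Empty using (⊥-elim)
open import Relation.Nullary using (¬_)
open import Relation.Nullary.Decidable using (⌊_⌋)
open import Function.Definitions using (Injective; Bijective)

record Graph : Set where
  field
    n    : ℕ
    E    : Fin n → Fin n → Bool
    E-sym : ∀ u v → E u v ≡ E v u
    E-irr : ∀ v → E v v ≡ false
open Graph public

K : ℕ → Graph
K m = record
  { n = m
  ; E = λ u v → not ⌊ u ≟ v ⌋
  ; E-sym = symK
  ; E-irr = irrK
  }
  where
  open import Relation.Binary.PropositionalEquality using (refl; sym)
  open import Relation.Nullary using (yes; no)
  symK : ∀ (u v : Fin m) → not ⌊ u ≟ v ⌋ ≡ not ⌊ v ≟ u ⌋
  symK u v with u ≟ v | v ≟ u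
  ... | yes _ | yes _ = refl
  ... | no _  | no _  = refl
  ... | yes p | no q  = ⊥-elim (q (sym p))
  ... | no p  | yes q = ⊥-elim (p (sym q))
  irrK : ∀ (v : Fin m) → not ⌊ v ≟ v ⌋ ≡ false
  irrK v with v ≟ v
  ... | yes _ = refl
  ... | no p  = ⊥-elim (p refl)

_≅_ : Graph → Graph → Set
G ≅ H = Σ (Fin (n G) → Fin (n H)) λ f →
          Bijective _≡_ _≡_ f × (∀ u v → E H (f u) (f v) ≡ E G u v)

V∖ : (H : Graph) → Fin (n H) → Set
V∖ H z = Σ (Fin (n H)) λ w → w ≢ z

-- Adjacency of the Ore composition, on the vertex set V(H₁) ⊔ (V(H₂) ∖ {z}).
-- The vertex x of H₁ plays the role of z₁, and y that of z₂.
-- side w = true means the neighbour w of z becomes a neighbour of z₁ (= x),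
-- side w = false means it becomes a neighbour of z₂ (= y).
oreAdj : (H₁ H₂ : Graph) (x y : Fin (n H₁)) (z : Fin (n H₂))
         (side : Fin (n H₂) → Bool) →
         Fin (n H₁) ⊎ V∖ H₂ z → Fin (n H₁) ⊎ V∖ H₂ z → Bool
oreAdj H₁ H₂ x y z side (inj₁ u) (inj₁ v) =
  E H₁ u v ∧ not ((⌊ u ≟ x ⌋ ∧ ⌊ v ≟ y ⌋) ∨ (⌊ u ≟ y ⌋ ∧ ⌊ v ≟ x ⌋))
oreAdj H₁ H₂ x y z side (inj₂ (u , _)) (inj₂ (v , _)) = E H₂ u v
oreAdj H₁ H₂ x y z side (inj₁ u) (inj₂ (w , _)) =
  E H₂ z w ∧ ((⌊ u ≟ x ⌋ ∧ side w) ∨ (⌊ u ≟ y ⌋ ∧ not (side w)))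
oreAdj H₁ H₂ x y z side (inj₂ (w , _)) (inj₁ u) =
  E H₂ z w ∧ ((⌊ u ≟ x ⌋ ∧ side w) ∨ (⌊ u ≟ y ⌋ ∧ not (side w)))

-- G is (isomorphic to) an Ore composition of H₁ and H₂: delete the edge xy
-- of H₁, split z of H₂ into z₁, z₂ of positive degree partitioning N(z),
-- identify x with z₁ and y with z₂.
OreComposition : Graph → Graph → Graph → Set
OreComposition H₁ H₂ G =
  Σ (Fin (n H₁)) λ x → Σ (Fin (n H₁)) λ y → Σ (Fin (n H₂)) λ z →
  Σ (Fin (n H₂) → Bool) λ side →
    E H₁ x y ≡ true
  × (∃ λ w → E H₂ z w ≡ true × side w ≡ true)
  × (∃ λ w → E H₂ z w ≡ true × side w ≡ false)
  × Σ (Fin (n H₁) ⊎ V∖ H₂ z → Fin (n G)) λ f →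
      Bijective _≡_ _≡_ f
    × (∀ a b → E G (f a) (f b) ≡ oreAdj H₁ H₂ x y z side a b)

data IsOre (k : ℕ) : Graph → Set where
  base : ∀ {G} → K k ≅ G → IsOre k G
  comp : ∀ {H₁ H₂ G} → IsOre k H₁ → IsOre k H₂ →
         OreComposition H₁ H₂ G → IsOre k G

IsClique : (G : Graph) (s : ℕ) → (Fin s → Fin (n G)) → Set
IsClique G s c = Injective _≡_ _≡_ c × (∀ a b → a ≢ b → E G (c a) (c b) ≡ true)

HasPacking : (G : Graph) (s t : ℕ) → Set
HasPacking G s t = Σ (Fin t → Fin s → Fin (n G)) λ c →
    (∀ i → IsClique G s (c i))
  × (∀ i j a b → c i a ≡ c j b → i ≡ j)

PackingNumber : (G : Graph) (s t : ℕ) → Set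
PackingNumber G s t = HasPacking G s t × (∀ t′ → HasPacking G s t′ → t′ ≤ t)

-- Every vertex v of a k-Ore graph is avoided by some copy of K_{k-1}: this holds
-- in K_k, and in an Ore composition of H₁ and H₂ a copy of K_{k-1} in H₁ missing x
-- survives in G on the H₁ side, while a copy in H₂ missing z survives on the H₂
-- side, and every vertex of G lies on exactly one of the two sides. For the same
-- reason these two copies are disjoint, so an Ore composition has T^{k-1} ≥ 2.
module Submission where

open import Defs
open import Data.Nat using (ℕ; _≤_; _∸_; suc; s≤s)
open import Data.Fin using (Fin; _≟_; punchIn) renaming (zero to fzero; suc to fsuc)
open import Data.Fin.Properties using (punchIn-injective; punchInᵢ≢i)
open import Data.Bool using (Bool; true; false; not; _∧_; _∨_)
open import Data.Bool.Properties using (∧-zeroʳ; ∧-identityʳ)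
open import Data.Sum using (_⊎_; inj₁; inj₂)
open import Data.Sum.Properties using (inj₁-injective; inj₂-injective)
open import Data.Product using (Σ; _×_; _,_)
open import Data.Product.Properties using (,-injectiveˡ)
open import Data.Empty using (⊥-elim)
open import Function using (_∘_)
open import Function.Definitions using (Injective; Surjective)
open import Relation.Binary.PropositionalEquality
open import Relation.Nullary.Decidable using (⌊_⌋; isYes≗does; dec-false)

⌊≟⌋-false : ∀ {m} {p q : Fin m} → p ≢ q → ⌊ p ≟ q ⌋ ≡ false
⌊≟⌋-false {p = p} {q} p≢q = trans (isYes≗does (p ≟ q)) (dec-false (p ≟ q) p≢q)

CliqueAvoiding : (G : Graph) (s : ℕ) → Fin (n G) → Set
CliqueAvoiding G s v = Σ (Fin s → Fin (n G)) λ c → IsClique G s c × (∀ a → c a ≢ v)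

isClique-transfer : ∀ H G {s} {c : Fin s → Fin (n H)} {d : Fin s → Fin (n G)} →
                    IsClique H s c →
                    (∀ {a b} → d a ≡ d b → c a ≡ c b) →
                    (∀ a b → E G (d a) (d b) ≡ E H (c a) (c b)) →
                    IsClique G s d
isClique-transfer _ _ (c-inj , c-adj) d-reflects d-adj =
  c-inj ∘ d-reflects , λ a b a≢b → trans (d-adj a b) (c-adj a b a≢b)

isClique-K : ∀ {m s} {c : Fin s → Fin m} → Injective _≡_ _≡_ c → IsClique (K m) s c
isClique-K c-inj = c-inj , λ a b a≢b → cong not (⌊≟⌋-false (a≢b ∘ c-inj))

twoDisjointCliques : ∀ G {s} {c d : Fin s → Fin (n G)} →
                     IsClique G s c → IsClique G s d → (∀ a b → c a ≢ d b) →
                     HasPacking G s 2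
twoDisjointCliques G {s} {c} {d} c-clique d-clique c≢d = cliques , isClique , disjoint
  where
  cliques : Fin 2 → Fin s → Fin (n G)
  cliques fzero    = c
  cliques (fsuc _) = d
  isClique : ∀ i → IsClique G s (cliques i)
  isClique fzero           = c-clique
  isClique (fsuc fzero)    = d-clique
  disjoint : ∀ i j a b → cliques i a ≡ cliques j b → i ≡ j
  disjoint fzero        fzero        _ _ _  = refl
  disjoint (fsuc fzero) (fsuc fzero) _ _ _  = refl
  disjoint fzero        (fsuc fzero) a b eq = ⊥-elim (c≢d a b eq)
  disjoint (fsuc fzero) fzero        a b eq = ⊥-elim (c≢d b a (sym eq))

K-cliqueAvoiding : ∀ s u → CliqueAvoiding (K (suc s)) s u
K-cliqueAvoiding s u = punchIn u , isClique-K (punchIn-injective u _ _) , punchInᵢ≢i u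

≅-cliqueAvoiding : ∀ H G {s} → H ≅ G →
                   (∀ u → CliqueAvoiding H s u) → ∀ v → CliqueAvoiding G s v
≅-cliqueAvoiding H G (g , (g-inj , g-surj) , g-adj) avoidH v
  with u , onto ← g-surj v with refl ← onto refl | c , c-clique , c-avoids ← avoidH u =
  g ∘ c , isClique-transfer H G c-clique g-inj (λ a b → g-adj (c a) (c b)) , λ a → c-avoids a ∘ g-inj

module Composition (H₁ H₂ G : Graph) {x y : Fin (n H₁)} {z : Fin (n H₂)}
                   {side : Fin (n H₂) → Bool}
                   (f : Fin (n H₁) ⊎ V∖ H₂ z → Fin (n G))
                   (f-inj : Injective _≡_ _≡_ f)
                   (f-adj : ∀ a b → E G (f a) (f b) ≡ oreAdj H₁ H₂ x y z side a b)
                   {s : ℕ} where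

  ι₁ : Fin (n H₁) → Fin (n G)
  ι₁ = f ∘ inj₁

  ι₂ : V∖ H₂ z → Fin (n G)
  ι₂ = f ∘ inj₂

  ι₁≢ι₂ : ∀ {u w} → ι₁ u ≢ ι₂ w
  ι₁≢ι₂ eq with () ← f-inj eq

  -- Only the deleted edge xy distinguishes G from H₁, and it is incident to x.
  ι₁-adj : ∀ {u v} → u ≢ x → v ≢ x → E G (ι₁ u) (ι₁ v) ≡ E H₁ u v
  ι₁-adj {u} {v} u≢x v≢x = begin
    E G (ι₁ u) (ι₁ v)
      ≡⟨ f-adj (inj₁ u) (inj₁ v) ⟩
    E H₁ u v ∧ not ((⌊ u ≟ x ⌋ ∧ ⌊ v ≟ y ⌋) ∨ (⌊ u ≟ y ⌋ ∧ ⌊ v ≟ x ⌋))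
      ≡⟨ cong₂ (λ p q → E H₁ u v ∧ not ((p ∧ ⌊ v ≟ y ⌋) ∨ (⌊ u ≟ y ⌋ ∧ q)))
               (⌊≟⌋-false u≢x) (⌊≟⌋-false v≢x) ⟩
    E H₁ u v ∧ not (false ∨ (⌊ u ≟ y ⌋ ∧ false))
      ≡⟨ cong (λ p → E H₁ u v ∧ not p) (∧-zeroʳ ⌊ u ≟ y ⌋) ⟩
    E H₁ u v ∧ true
      ≡⟨ ∧-identityʳ (E H₁ u v) ⟩
    E H₁ u v ∎
    where open ≡-Reasoning

  liftClique₁ : CliqueAvoiding H₁ s x → Σ (Fin s → Fin (n H₁)) λ c → IsClique G s (ι₁ ∘ c)
  liftClique₁ (c , c-clique , c-avoids) =
    c , isClique-transfer H₁ G c-clique (inj₁-injective ∘ f-inj)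
                          (λ a b → ι₁-adj (c-avoids a) (c-avoids b))

  liftClique₂ : CliqueAvoiding H₂ s z → Σ (Fin s → V∖ H₂ z) λ c → IsClique G s (ι₂ ∘ c)
  liftClique₂ (c , c-clique , c-avoids) =
    c′ , isClique-transfer H₂ G c-clique (,-injectiveˡ ∘ inj₂-injective ∘ f-inj)
                           (λ a b → f-adj (inj₂ (c′ a)) (inj₂ (c′ b)))
    where
    c′ : Fin s → V∖ H₂ z
    c′ a = c a , c-avoids a

  packing : CliqueAvoiding H₁ s x → CliqueAvoiding H₂ s z → HasPacking G s 2
  packing avoid₁ avoid₂ with c₁ , clique₁ ← liftClique₁ avoid₁
                           | c₂ , clique₂ ← liftClique₂ avoid₂ =
    twoDisjointCliques G clique₁ clique₂ (λ _ _ → ι₁≢ι₂)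

  cliqueAvoiding : CliqueAvoiding H₁ s x → CliqueAvoiding H₂ s z →
                   Surjective _≡_ _≡_ f → ∀ v → CliqueAvoiding G s v
  cliqueAvoiding avoid₁ avoid₂ f-surj v with f-surj v
  ... | inj₁ u , onto with refl ← onto refl | c₂ , clique₂ ← liftClique₂ avoid₂ =
    ι₂ ∘ c₂ , clique₂ , λ a eq → ι₁≢ι₂ (sym eq)
  ... | inj₂ w , onto with refl ← onto refl | c₁ , clique₁ ← liftClique₁ avoid₁ =
    ι₁ ∘ c₁ , clique₁ , λ a → ι₁≢ι₂

ore-cliqueAvoiding : ∀ {s} G → IsOre (suc s) G → ∀ v → CliqueAvoiding G s v
ore-cliqueAvoiding G (base iso) = ≅-cliqueAvoiding (K _) G iso (K-cliqueAvoiding _)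
ore-cliqueAvoiding G (comp {H₁} {H₂} ore₁ ore₂
                           (x , _ , z , _ , _ , _ , _ , f , (f-inj , f-surj) , f-adj)) =
  Composition.cliqueAvoiding H₁ H₂ G f f-inj f-adj
    (ore-cliqueAvoiding H₁ ore₁ x) (ore-cliqueAvoiding H₂ ore₂ z) f-surj

ore-packing : ∀ {s} H₁ H₂ G → IsOre (suc s) H₁ → IsOre (suc s) H₂ →
              OreComposition H₁ H₂ G → HasPacking G s 2
ore-packing H₁ H₂ G ore₁ ore₂ (x , _ , z , _ , _ , _ , _ , f , (f-inj , _) , f-adj) =
  Composition.packing H₁ H₂ G f f-inj f-adj
    (ore-cliqueAvoiding H₁ ore₁ x) (ore-cliqueAvoiding H₂ ore₂ z)

corollary2p6 : (k : ℕ) → 2 ≤ k → (G : Graph) → IsOre k G →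
               PackingNumber G (k ∸ 1) 1 → K k ≅ G
corollary2p6 k       _ G (base iso)                       _              = iso
corollary2p6 (suc s) _ G (comp {H₁} {H₂} ore₁ ore₂ split) (_ , maximum)
  with s≤s () ← maximum 2 (ore-packing H₁ H₂ G ore₁ ore₂ split)
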